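{- Let $b \ge 2$ be an integer, let $m = 2b+1$, and let $f(x) = x^{2b+1} + x^{b+1} + x^{b} + x + 1 \in \mathbb{F}_2[x]$. There is a Boolean circuit consisting only of 2-input XOR gates (and no AND gates) that takes as input the coefficients $d_0, \dots, d_{2m-2} \in \mathbb{F}_2$ of an arbitrary polynomial $D(x) = \sum_{i=0}^{2m-2} d_i x^i \in \mathbb{F}_2[x]$ (of degree at most $2m-2$) and outputs the $m$ coefficients of the remainder $D \bmod f$ (the unique polynomial of degree less than $m$ congruent to $D$ modulo $f$). This circuit uses exactly $N_\oplus = 3m-2 = 6b+1$ XOR gates and has time delay $3T_X$, i.e. every output is obtained through at most $3$ consecutive levels of XOR gates.
   Context: Arithmetic is over the binary field $\mathbb{F}_2$, where addition is XOR. $T_X$ denotes the delay of one 2-input XOR gate; the time delay of a circuit is the delay along its longest input-to-output path. The circuit realizes the reduction step of a two-step multiplier in $\mathbb{F}_{2^m} \cong \mathbb{F}_2[x]/(f)$: a product of two polynomials of degree less than $m$ has degree at most $2m-2$ and is then reduced modulo $f$. -}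

module Defs where

open import Data.Bool using (Bool; true; false; _xor_; _∧_; if_then_else_)
open import Data.Nat using (ℕ; zero; suc; _+_; _*_; _⊔_)
open import Data.Fin using (Fin)
open import Data.List using (List; []; _∷_; replicate; _++_)
open import Data.Vec using (Vec; lookup; _∷ʳ_)
open import Relation.Binary.PropositionalEquality using (_≡_)

-- Polynomials over F₂ = Bool (addition is xor, multiplication is ∧),
-- represented by little-endian coefficient lists (index i = coeff of x^i).

Poly : Set
Poly = List Bool

coeff : Poly → ℕ → Bool
coeff []       _       = false
coeff (a ∷ p)  zero    = a
coeff (a ∷ p)  (suc i) = coeff p i

_+ₚ_ : Poly → Poly → Poly
[]      +ₚ q       = q
(a ∷ p) +ₚ []      = a ∷ p
(a ∷ p) +ₚ (c ∷ q) = (a xor c) ∷ (p +ₚ q)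

infixl 6 _+ₚ_
infixl 7 _*ₚ_

_*ₚ_ : Poly → Poly → Poly
[]      *ₚ q = []
(a ∷ p) *ₚ q = (if a then q else []) +ₚ (false ∷ (p *ₚ q))

-- equality of polynomials (coefficientwise; ignores trailing zeros)
_≈ₚ_ : Poly → Poly → Set
p ≈ₚ q = ∀ i → coeff p i ≡ coeff q i

X^ : ℕ → Poly
X^ k = replicate k false ++ (true ∷ [])

fpoly : ℕ → Poly
fpoly b = X^ (2 * b + 1) +ₚ X^ (b + 1) +ₚ X^ b +ₚ X^ 1 +ₚ X^ 0

-- XOR-only Boolean circuits (straight-line programs of 2-input XOR gates).
-- Circ n g w : a circuit on n input wires having g gates and w wires in
-- total (inputs followed by gate outputs); each new gate XORs two
-- previously existing wires.

data Circ (n : ℕ) : ℕ → ℕ → Set where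
  inputs : Circ n 0 n
  xorGate : ∀ {g w} → Circ n g w → Fin w → Fin w → Circ n (suc g) (suc w)

values : ∀ {n g w} → Circ n g w → Vec Bool n → Vec Bool w
values inputs x = x
values (xorGate C i j) x =
  let v = values C x in v ∷ʳ (lookup v i xor lookup v j)

depths : ∀ {n g w} → Circ n g w → Vec ℕ w
depths {n} inputs = Data.Vec.replicate n 0
depths (xorGate C i j) =
  let d = depths C in d ∷ʳ suc (lookup d i ⊔ lookup d j)

record XorCircuit (n k g : ℕ) : Set where
  field
    wires   : ℕ
    circ    : Circ n g wires
    outputs : Vec (Fin wires) k

open XorCircuit public

run : ∀ {n k g} → XorCircuit n k g → Vec Bool n → Vec Bool k
run C x = Data.Vec.map (lookup (values (circ C) x)) (outputs C)

-- delay, in units of T_X: the maximum depth over all outputs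
delay : ∀ {n k g} → XorCircuit n k g → ℕ
delay C = Data.Vec.foldr _ _⊔_ 0 (Data.Vec.map (lookup (depths (circ C))) (outputs C))

module Submission where

-- Write the input as D = L + x^m H, H = h_0 + ... + h_(2b-1) x^(2b-1), and
-- put V_s = h_s + h_(b+s), Z_t = h_t + h_(b+t+1).  The circuit has three XOR
-- layers.  Layer 1 computes V_0 .. V_(b-1) and Z_0 .. Z_(b-2) (2b - 1 gates;
-- Z_(b-1) = h_(b-1) and Z_b = h_b are inputs, as h vanishes from index 2b on).
-- Layers 2 and 3 (m gates each) compute the outputs O_k = (d_k + Z_(π k)) + X_k
-- for k < m, where π and X are given piecewise below.  So there are 3m - 2
-- gates and the delay is 3.  Correctness is witnessed by the explicit quotient
-- q_j = h_j + h_(b+j) + h_(b+j+1): coefficientwise D = O + q f.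

open import Defs
open import Data.Bool using (Bool; true; false; _xor_; _∧_; if_then_else_)
open import Data.Bool.Properties using (xor-∧-commutativeRing; xor-identityʳ; xor-assoc)
open import Data.Fin using (Fin; toℕ)
open import Data.Fin.Properties using (toℕ-fromℕ<)
open import Data.List using ([]; _∷_; replicate; _++_)
open import Data.Maybe using (Maybe; just; nothing)
open import Data.Nat using (ℕ; zero; suc; _+_; _*_; _∸_; _≤_; _<_; _⊔_; z≤n; s≤s; _<?_; _%_)
open import Data.Nat.DivMod using (_mod_; m<n⇒m%n≡m)
open import Data.Nat.Properties
open import Data.Product using (Σ; _×_; _,_; ∃)
open import Data.Sum using (_⊎_; inj₁; inj₂)
open import Data.Vec using (Vec; []; _∷_; _∷ʳ_; lookup; tabulate; toList; map; foldr)
open import Data.Vec.Properties using (tabulate-∘)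
open import Function using (_∘_)
open import Relation.Binary.PropositionalEquality
open import Relation.Nullary using (yes; no; contradiction)
open import Tactic.RingSolver using (solve-∀)
open import Tactic.RingSolver.Core.AlmostCommutativeRing using (AlmostCommutativeRing; fromCommutativeRing)
import Data.Nat.Tactic.RingSolver as ℕ-Ring
open import Level using (0ℓ)
open ≡-Reasoning

-- Coefficients are normalised inside F₂ itself, so x xor x ≡ false
-- is found automatically; this discharges every XOR identity below.
isFalse : (x : Bool) → Maybe (false ≡ x)
isFalse false = just refl
isFalse true  = nothing

𝔽₂ : AlmostCommutativeRing 0ℓ 0ℓ
𝔽₂ = fromCommutativeRing xor-∧-commutativeRing isFalse

below-or-offset : ∀ a i → i < a ⊎ ∃ λ j → i ≡ a + j
below-or-offset zero    i       = inj₂ (i , refl)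
below-or-offset (suc a) zero    = inj₁ (s≤s z≤n)
below-or-offset (suc a) (suc i) with below-or-offset a i
... | inj₁ i<a       = inj₁ (s≤s i<a)
... | inj₂ (j , i≡a+j) = inj₂ (j , cong suc i≡a+j)

-- A sequence given by f below the threshold a and by g from a on.  It is
-- kept abstract: it is only ever used through its two defining equations.
abstract
  piecewise : ∀ {A : Set} → ℕ → (ℕ → A) → (ℕ → A) → ℕ → A
  piecewise a f g t with t <? a
  ... | yes _ = f t
  ... | no  _ = g t

  piecewise-< : ∀ {A : Set} {a t} (f g : ℕ → A) → t < a → piecewise a f g t ≡ f t
  piecewise-< {a = a} {t} f g t<a with t <? a
  ... | yes _   = refl
  ... | no  t≮a = contradiction t<a t≮a

  piecewise-≥ : ∀ {A : Set} {a t} (f g : ℕ → A) → a ≤ t → piecewise a f g t ≡ g t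
  piecewise-≥ {a = a} {t} f g a≤t with t <? a
  ... | yes t<a = contradiction a≤t (<⇒≱ t<a)
  ... | no  _   = refl

-- Entries of a vector indexed by a natural number, with a default value
-- past the end; circuits are described with natural-number wire indices.
entry : ∀ {A : Set} {n} → A → Vec A n → ℕ → A
entry a []      i       = a
entry a (x ∷ v) zero    = x
entry a (x ∷ v) (suc i) = entry a v i

entry-lookup : ∀ {A : Set} {n} (a : A) (v : Vec A n) f → lookup v f ≡ entry a v (toℕ f)
entry-lookup a (x ∷ v) Fin.zero    = refl
entry-lookup a (x ∷ v) (Fin.suc f) = entry-lookup a v f

entry-mod : ∀ {A : Set} {w} (a : A) (v : Vec A (suc w)) i → i < suc w → lookup v (i mod suc w) ≡ entry a v i
entry-mod {w = w} a v i i<w = begin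
  lookup v (i mod suc w)          ≡⟨ entry-lookup a v (i mod suc w) ⟩
  entry a v (toℕ (i mod suc w))   ≡⟨ cong (entry a v) (toℕ-fromℕ< _) ⟩
  entry a v (i % suc w)           ≡⟨ cong (entry a v) (m<n⇒m%n≡m i<w) ⟩
  entry a v i                     ∎

entry-past : ∀ {A : Set} {n} (a : A) (v : Vec A n) i → n ≤ i → entry a v i ≡ a
entry-past a []      i       _         = refl
entry-past a (x ∷ v) (suc i) (s≤s n≤i) = entry-past a v i n≤i

entry-∷ʳ-old : ∀ {A : Set} {n} (a : A) (v : Vec A n) y i → i < n → entry a (v ∷ʳ y) i ≡ entry a v i
entry-∷ʳ-old a (x ∷ v) y zero    _         = refl
entry-∷ʳ-old a (x ∷ v) y (suc i) (s≤s i<n) = entry-∷ʳ-old a v y i i<n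

entry-∷ʳ-new : ∀ {A : Set} {n} (a : A) (v : Vec A n) y → entry a (v ∷ʳ y) n ≡ y
entry-∷ʳ-new a []      y = refl
entry-∷ʳ-new a (x ∷ v) y = entry-∷ʳ-new a v y

entry-∷ʳ : ∀ {A : Set} {n} (a : A) (v : Vec A n) y i →
  entry a (v ∷ʳ y) i ≡ y ⊎ entry a (v ∷ʳ y) i ≡ entry a v i
entry-∷ʳ a []      y zero    = inj₁ refl
entry-∷ʳ a []      y (suc i) = inj₂ refl
entry-∷ʳ a (x ∷ v) y zero    = inj₂ refl
entry-∷ʳ a (x ∷ v) y (suc i) = entry-∷ʳ a v y i

entry-tabulate : ∀ {A : Set} {n} (a : A) (f : ℕ → A) i → i < n → entry a (tabulate {n = n} (f ∘ toℕ)) i ≡ f i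
entry-tabulate {n = suc n} a f zero    _         = refl
entry-tabulate {n = suc n} a f (suc i) (s≤s i<n) = entry-tabulate a (f ∘ suc) i i<n

coeff-toList : ∀ {n} (v : Vec Bool n) i → coeff (toList v) i ≡ entry false v i
coeff-toList []      i       = refl
coeff-toList (x ∷ v) zero    = refl
coeff-toList (x ∷ v) (suc i) = coeff-toList v i

-- A layer of c XOR gates on top of a circuit C with suc w wires: gate t
-- combines wires l t and r t of C and becomes wire suc (t + w).
layer : ∀ {n g w} → Circ n g (suc w) → (c : ℕ) → (l r : ℕ → ℕ) → Circ n (c + g) (suc (c + w))
layer         C zero    l r = C
layer {w = w} C (suc c) l r = xorGate (layer C c l r) (l c mod suc (c + w)) (r c mod suc (c + w))

-- Value and depth of wire i (false and 0 past the last wire).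
wire : ∀ {n g w} → Circ n g w → Vec Bool n → ℕ → Bool
wire C x i = entry false (values C x) i

depth : ∀ {n g w} → Circ n g w → ℕ → ℕ
depth C i = entry 0 (depths C) i

wire-range-weaken : ∀ c w {i} → i < suc w → i < suc (c + w)
wire-range-weaken c w i<w = ≤-trans i<w (s≤s (m≤n+m w c))

layer-wire-old : ∀ {n g w} (C : Circ n g (suc w)) c l r x i → i < suc w → wire (layer C c l r) x i ≡ wire C x i
layer-wire-old         C zero    l r x i i<w = refl
layer-wire-old {w = w} C (suc c) l r x i i<w =
  trans (entry-∷ʳ-old false (values (layer C c l r) x) _ i (wire-range-weaken c w i<w)) (layer-wire-old C c l r x i i<w)

layer-depth-old : ∀ {n g w} (C : Circ n g (suc w)) c l r i → i < suc w → depth (layer C c l r) i ≡ depth C i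
layer-depth-old         C zero    l r i i<w = refl
layer-depth-old {w = w} C (suc c) l r i i<w =
  trans (entry-∷ʳ-old 0 (depths (layer C c l r)) _ i (wire-range-weaken c w i<w)) (layer-depth-old C c l r i i<w)

layer-wire-new : ∀ {n g w} (C : Circ n g (suc w)) c l r x t → t < c → l t < suc w → r t < suc w →
  wire (layer C c l r) x (suc (t + w)) ≡ (wire C x (l t) xor wire C x (r t))
layer-wire-new {w = w} C (suc c) l r x t t<c lt<w rt<w with m<1+n⇒m<n∨m≡n t<c
... | inj₁ t<c′ = trans (entry-∷ʳ-old false (values (layer C c l r) x) _ _ (s≤s (+-monoˡ-< w t<c′)))
                        (layer-wire-new C c l r x t t<c′ lt<w rt<w)
... | inj₂ refl = trans (entry-∷ʳ-new false (values (layer C t l r) x) _) (cong₂ _xor_ (read lt<w) (read rt<w))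
  where
    read : ∀ {i} → i < suc w → lookup (values (layer C t l r) x) (i mod suc (t + w)) ≡ wire C x i
    read {i} i<w = trans (entry-mod false (values (layer C t l r) x) i (wire-range-weaken t w i<w)) (layer-wire-old C t l r x i i<w)

DepthBound : ∀ {n g w} → ℕ → Circ n g w → Set
DepthBound L C = ∀ i → depth C i ≤ L

inputs-depth : ∀ {n} → DepthBound 0 (inputs {n})
inputs-depth {zero}  i       = z≤n
inputs-depth {suc n} zero    = z≤n
inputs-depth {suc n} (suc i) = inputs-depth {n} i

layer-depth : ∀ {n g w} (C : Circ n g (suc w)) c l r {L} → (∀ t → t < c → l t < suc w) → (∀ t → t < c → r t < suc w) →
  DepthBound L C → DepthBound (suc L) (layer C c l r)
layer-depth         C zero    l r l<w r<w bound i = m≤n⇒m≤1+n (bound i)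
layer-depth {w = w} C (suc c) l r {L} l<w r<w bound i with entry-∷ʳ 0 (depths (layer C c l r)) _ i
... | inj₂ old = subst (_≤ suc L) (sym old)
                   (layer-depth C c l r (λ t → l<w t ∘ m≤n⇒m≤1+n) (λ t → r<w t ∘ m≤n⇒m≤1+n) bound i)
... | inj₁ new = subst (_≤ suc L) (sym new) (s≤s (⊔-lub (read (l<w c ≤-refl)) (read (r<w c ≤-refl))))
  where
    read : ∀ {j} → j < suc w → lookup (depths (layer C c l r)) (j mod suc (c + w)) ≤ L
    read {j} j<w = subst (_≤ L)
      (sym (trans (entry-mod 0 (depths (layer C c l r)) j (wire-range-weaken c w j<w)) (layer-depth-old C c l r j j<w)))
      (bound j)

delay-bound : ∀ {n k g} (C : XorCircuit n k g) {L} → DepthBound L (circ C) → delay C ≤ L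
delay-bound C {L} bound = go (outputs C)
  where
    go : ∀ {k} (os : Vec (Fin (wires C)) k) → foldr _ _⊔_ 0 (map (lookup (depths (circ C))) os) ≤ L
    go []       = z≤n
    go (o ∷ os) = ⊔-lub (subst (_≤ L) (sym (entry-lookup 0 (depths (circ C)) o)) (bound (toℕ o))) (go os)

coeff-+ : ∀ p q i → coeff (p +ₚ q) i ≡ (coeff p i xor coeff q i)
coeff-+ []      q       i       = refl
coeff-+ (a ∷ p) []      i       = sym (xor-identityʳ _)
coeff-+ (a ∷ p) (c ∷ q) zero    = refl
coeff-+ (a ∷ p) (c ∷ q) (suc i) = coeff-+ p q i

coeff-*-∷ : ∀ a p B i → coeff ((a ∷ p) *ₚ B) i ≡ ((a ∧ coeff B i) xor coeff (false ∷ (p *ₚ B)) i)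
coeff-*-∷ a p B i = trans (coeff-+ (if a then B else []) _ i) (cong (_xor _) (coeff-if a))
  where
    coeff-if : ∀ a → coeff (if a then B else []) i ≡ (a ∧ coeff B i)
    coeff-if true  = refl
    coeff-if false = refl

coeff-*-+ : ∀ q A B i → coeff (q *ₚ (A +ₚ B)) i ≡ (coeff (q *ₚ A) i xor coeff (q *ₚ B) i)
coeff-*-+ []      A B i = refl
coeff-*-+ (a ∷ p) A B i = begin
  coeff ((a ∷ p) *ₚ (A +ₚ B)) i
    ≡⟨ coeff-*-∷ a p (A +ₚ B) i ⟩
  (a ∧ coeff (A +ₚ B) i) xor coeff (false ∷ (p *ₚ (A +ₚ B))) i
    ≡⟨ cong₂ (λ s u → (a ∧ s) xor u) (coeff-+ A B i) (shifted i) ⟩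
  (a ∧ (coeff A i xor coeff B i)) xor (coeff (false ∷ (p *ₚ A)) i xor coeff (false ∷ (p *ₚ B)) i)
    ≡⟨ interchange a (coeff A i) (coeff B i) _ _ ⟩
  ((a ∧ coeff A i) xor coeff (false ∷ (p *ₚ A)) i) xor ((a ∧ coeff B i) xor coeff (false ∷ (p *ₚ B)) i)
    ≡⟨ sym (cong₂ _xor_ (coeff-*-∷ a p A i) (coeff-*-∷ a p B i)) ⟩
  coeff ((a ∷ p) *ₚ A) i xor coeff ((a ∷ p) *ₚ B) i
    ∎
  where
    interchange : ∀ a y z u v → ((a ∧ (y xor z)) xor (u xor v)) ≡ (((a ∧ y) xor u) xor ((a ∧ z) xor v))
    interchange = solve-∀ 𝔽₂
    shifted : ∀ i → coeff (false ∷ (p *ₚ (A +ₚ B))) i ≡ (coeff (false ∷ (p *ₚ A)) i xor coeff (false ∷ (p *ₚ B)) i)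
    shifted zero    = refl
    shifted (suc i) = coeff-*-+ p A B i

shift : ℕ → Poly → Poly
shift k q = replicate k false ++ q

coeff-shift-< : ∀ q {k i} → i < k → coeff (shift k q) i ≡ false
coeff-shift-< q {suc k} {zero}  _         = refl
coeff-shift-< q {suc k} {suc i} (s≤s i<k) = coeff-shift-< q i<k

coeff-shift : ∀ q k {i} j → i ≡ k + j → coeff (shift k q) i ≡ coeff q j
coeff-shift q zero    j refl = refl
coeff-shift q (suc k) j refl = coeff-shift q k j refl

coeff-shift-[] : ∀ k i → coeff (shift k []) i ≡ false
coeff-shift-[] zero    i       = refl
coeff-shift-[] (suc k) zero    = refl
coeff-shift-[] (suc k) (suc i) = coeff-shift-[] k i

coeff-shift-∷ : ∀ a p k i → coeff (shift k (a ∷ p)) i ≡ ((a ∧ coeff (X^ k) i) xor coeff (shift (suc k) p) i)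
coeff-shift-∷ true  p zero    zero    = refl
coeff-shift-∷ false p zero    zero    = refl
coeff-shift-∷ true  p zero    (suc i) = refl
coeff-shift-∷ false p zero    (suc i) = refl
coeff-shift-∷ true  p (suc k) zero    = refl
coeff-shift-∷ false p (suc k) zero    = refl
coeff-shift-∷ a     p (suc k) (suc i) = coeff-shift-∷ a p k i

coeff-*-X^ : ∀ q k i → coeff (q *ₚ X^ k) i ≡ coeff (shift k q) i
coeff-*-X^ []      k i = sym (coeff-shift-[] k i)
coeff-*-X^ (a ∷ p) k i = begin
  coeff ((a ∷ p) *ₚ X^ k) i                                   ≡⟨ coeff-*-∷ a p (X^ k) i ⟩
  (a ∧ coeff (X^ k) i) xor coeff (false ∷ (p *ₚ X^ k)) i      ≡⟨ cong ((a ∧ coeff (X^ k) i) xor_) (shifted i) ⟩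
  (a ∧ coeff (X^ k) i) xor coeff (shift (suc k) p) i          ≡⟨ sym (coeff-shift-∷ a p k i) ⟩
  coeff (shift k (a ∷ p)) i                                   ∎
  where
    shifted : ∀ i → coeff (false ∷ (p *ₚ X^ k)) i ≡ coeff (shift (suc k) p) i
    shifted zero    = refl
    shifted (suc i) = coeff-*-X^ p k i

coeff-*-fpoly : ∀ b q i → coeff (q *ₚ fpoly b) i ≡
  ((((coeff (shift (2 * b + 1) q) i xor coeff (shift (b + 1) q) i) xor coeff (shift b q) i)
      xor coeff (shift 1 q) i) xor coeff q i)
coeff-*-fpoly b q i =
  trans (coeff-*-+ q _ (X^ 0) i) (cong₂ _xor_
    (trans (coeff-*-+ q _ (X^ 1) i) (cong₂ _xor_
      (trans (coeff-*-+ q _ (X^ b) i) (cong₂ _xor_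
        (trans (coeff-*-+ q _ (X^ (b + 1)) i) (cong₂ _xor_ (coeff-*-X^ q (2 * b + 1) i) (coeff-*-X^ q (b + 1) i)))
        (coeff-*-X^ q b i)))
      (coeff-*-X^ q 1 i)))
    (coeff-*-X^ q 0 i))

polyOf : ℕ → (ℕ → Bool) → Poly
polyOf k c = toList (tabulate {n = k} (c ∘ toℕ))

coeff-polyOf : ∀ k c j → (k ≤ j → c j ≡ false) → coeff (polyOf k c) j ≡ c j
coeff-polyOf k c j vanish with <-≤-connex j k
... | inj₁ j<k = trans (coeff-toList (tabulate {n = k} (c ∘ toℕ)) j) (entry-tabulate false c j j<k)
... | inj₂ k≤j = trans (coeff-toList (tabulate {n = k} (c ∘ toℕ)) j)
                       (trans (entry-past false (tabulate {n = k} (c ∘ toℕ)) j k≤j) (sym (vanish k≤j)))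

offset-< : ∀ a {k o} → a ≤ k → k < a + o → k ∸ a < o
offset-< a {k} {o} a≤k k<a+o = subst (k ∸ a <_) (m+n∸m≡n a o) (∸-monoˡ-< k<a+o a≤k)

degree-eq : ∀ b → 2 * b + 1 ≡ suc (b + b)
degree-eq = solve-∀ ℕ-Ring.ring

top-shift-eq : ∀ b j → suc ((b + b) + j) ≡ b + (b + suc j)
top-shift-eq = solve-∀ ℕ-Ring.ring

input-count-eq : ∀ b → 2 * (2 * b + 1) ≡ suc (suc ((b + b) + (b + b)))
input-count-eq = solve-∀ ℕ-Ring.ring

gate-count-eq : ∀ b' → 3 * (2 * suc b' + 1) ≡
  suc (suc (suc (suc b' + suc b') + (suc (suc b' + suc b') + ((suc b' + b') + 0))))
gate-count-eq = solve-∀ ℕ-Ring.ring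

-- The construction for b = b' + 1 (it needs b ≥ 1 only).
module Construction (b' : ℕ) where

  b : ℕ
  b = suc b'

  m : ℕ
  m = suc (b + b)

  -- The 2m - 1 inputs are the wires 0 .. w₀; layer 1 has c₁ = 2b - 1 gates,
  -- after layer 1 the last wire is w₁, after layer 2 it is w₂.
  w₀ c₁ w₁ w₂ : ℕ
  w₀ = (b + b) + (b + b)
  c₁ = b + b'
  w₁ = c₁ + w₀
  w₂ = m + w₁

  b≤2b : b ≤ b + b
  b≤2b = m≤m+n b b

  -- Input wire of h_t = d_(m+t), and wire of gate g of layer 1.
  hWire gate₁ : ℕ → ℕ
  hWire t = m + t
  gate₁ g = suc (g + w₀)

  -- Layer 1: gate s < b computes V_s = h_s + h_(b+s), gate b + t computes
  -- Z_t = h_t + h_(b+t+1).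
  left₁ right₁ : ℕ → ℕ
  left₁  = piecewise b hWire (λ g → hWire (g ∸ b))
  right₁ = piecewise b (λ s → hWire (b + s)) (λ g → hWire (b + suc (g ∸ b)))

  -- The wires carrying V_s (s < b) and Z_t (t ≤ b); Z_t is a gate of
  -- layer 1 for t < b - 1 and the input h_t otherwise.
  vWire zWire : ℕ → ℕ
  vWire = gate₁
  zWire = piecewise b' (λ t → gate₁ (b + t)) hWire

  -- Output k is (d_k + Z_(π k)) + X_k, where π k = k for k < b and
  -- k - b - 1 from b on, X_0 = Z_b, and X_(k+1) is V_k for k < b and
  -- Z_(k-b+1) from b on; xWire k is the wire carrying X_k.
  π xWire : ℕ → ℕ
  π = piecewise b (λ k → k) (λ k → k ∸ suc b)
  xWire zero    = zWire b
  xWire (suc k) = piecewise b vWire (λ k → zWire (suc (k ∸ b))) k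

  gates : ℕ
  gates = m + (m + (c₁ + 0))

  C₁ : Circ (suc w₀) (c₁ + 0) (suc w₁)
  C₁ = layer inputs c₁ left₁ right₁

  C₂ : Circ (suc w₀) (m + (c₁ + 0)) (suc w₂)
  C₂ = layer C₁ m (λ k → k) (zWire ∘ π)

  C₃ : Circ (suc w₀) gates (suc (m + w₂))
  C₃ = layer C₂ m (λ k → suc (k + w₁)) xWire

  circuit : XorCircuit (suc w₀) m gates
  circuit = record
    { wires   = suc (m + w₂)
    ; circ    = C₃
    ; outputs = tabulate (λ k → suc (toℕ k + w₂) mod suc (m + w₂))
    }

  left₁-low : ∀ {s} → s < b → left₁ s ≡ hWire s
  left₁-low = piecewise-< _ _

  left₁-high : ∀ u → left₁ (b + u) ≡ hWire u
  left₁-high u = trans (piecewise-≥ _ _ (m≤m+n b u)) (cong hWire (m+n∸m≡n b u))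

  right₁-low : ∀ {s} → s < b → right₁ s ≡ hWire (b + s)
  right₁-low = piecewise-< _ _

  right₁-high : ∀ u → right₁ (b + u) ≡ hWire (b + suc u)
  right₁-high u = trans (piecewise-≥ _ _ (m≤m+n b u)) (cong (λ v → hWire (b + suc v)) (m+n∸m≡n b u))

  π-middle : π b ≡ 0
  π-middle = trans (piecewise-≥ _ _ ≤-refl) (m≤n⇒m∸n≡0 (n≤1+n b))

  π-high : ∀ j → π (suc (b + j)) ≡ j
  π-high j = trans (piecewise-≥ _ _ (m≤n⇒m≤1+n (m≤m+n b j))) (m+n∸m≡n b j)

  xWire-high : ∀ j → xWire (suc (b + j)) ≡ zWire (suc j)
  xWire-high j = trans (piecewise-≥ _ _ (m≤m+n b j)) (cong (zWire ∘ suc) (m+n∸m≡n b j))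

  hWire-range : ∀ {t} → t < b + b → hWire t < suc w₀
  hWire-range t<2b = s≤s (+-monoʳ-< (b + b) t<2b)

  gate₁-range : ∀ {g} → g < c₁ → gate₁ g < suc w₁
  gate₁-range g<c₁ = s≤s (+-monoˡ-< w₀ g<c₁)

  left₁-range : ∀ g → g < c₁ → left₁ g < suc w₀
  left₁-range g g<c₁ with below-or-offset b g
  ... | inj₁ g<b        = subst (_< suc w₀) (sym (left₁-low g<b)) (hWire-range (<-≤-trans g<b b≤2b))
  ... | inj₂ (u , refl) = subst (_< suc w₀) (sym (left₁-high u))
                            (hWire-range (<-≤-trans (m<n⇒m<1+n (+-cancelˡ-< b u b' g<c₁)) b≤2b))

  right₁-range : ∀ g → g < c₁ → right₁ g < suc w₀
  right₁-range g g<c₁ with below-or-offset b g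
  ... | inj₁ g<b        = subst (_< suc w₀) (sym (right₁-low g<b)) (hWire-range (+-monoʳ-< b g<b))
  ... | inj₂ (u , refl) = subst (_< suc w₀) (sym (right₁-high u))
                            (hWire-range (+-monoʳ-< b (s≤s (+-cancelˡ-< b u b' g<c₁))))

  zWire-range : ∀ t → t ≤ b → zWire t < suc w₁
  zWire-range t t≤b with <-≤-connex t b'
  ... | inj₁ t<b' = subst (_< suc w₁) (sym (piecewise-< _ _ t<b')) (gate₁-range (+-monoʳ-< b t<b'))
  ... | inj₂ b'≤t = subst (_< suc w₁) (sym (piecewise-≥ _ _ b'≤t))
                     (wire-range-weaken c₁ w₀ (hWire-range (≤-<-trans t≤b (m<m+n b (s≤s z≤n)))))

  π-range : ∀ k → k < m → π k ≤ b
  π-range k k<m with <-≤-connex k b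
  ... | inj₁ k<b = subst (_≤ b) (sym (piecewise-< _ _ k<b)) (<⇒≤ k<b)
  ... | inj₂ b≤k = subst (_≤ b) (sym (piecewise-≥ _ _ b≤k)) (m≤n+o⇒m∸n≤o k (suc b) (m≤n⇒m≤1+n (≤-pred k<m)))

  xWire-range : ∀ k → k < m → xWire k < suc w₁
  xWire-range zero    _    = zWire-range b ≤-refl
  xWire-range (suc k) k<m with <-≤-connex k b
  ... | inj₁ k<b = subst (_< suc w₁) (sym (piecewise-< _ _ k<b)) (gate₁-range (<-≤-trans k<b (m≤m+n b b')))
  ... | inj₂ b≤k = subst (_< suc w₁) (sym (piecewise-≥ _ _ b≤k))
                    (zWire-range _ (offset-< b b≤k (≤-pred k<m)))

  left₂-range : ∀ k → k < m → k < suc w₁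
  left₂-range k k<m = ≤-trans k<m (s≤s (≤-trans (m≤m+n (b + b) (b + b)) (m≤n+m w₀ c₁)))

  left₃-range : ∀ k → k < m → suc (k + w₁) < suc w₂
  left₃-range k k<m = s≤s (+-monoˡ-< w₁ k<m)

  circuit-depth : DepthBound 3 C₃
  circuit-depth =
    layer-depth C₂ m _ xWire left₃-range (λ k → wire-range-weaken m w₁ ∘ xWire-range k)
      (layer-depth C₁ m _ _ left₂-range (λ k k<m → zWire-range (π k) (π-range k k<m))
        (layer-depth inputs c₁ left₁ right₁ left₁-range right₁-range (inputs-depth {suc w₀})))

  module Evaluation (x : Vec Bool (suc w₀)) where

    d h V Z quot : ℕ → Bool
    d i    = entry false x i
    h t    = d (hWire t)
    V s    = h s xor h (b + s)
    Z t    = h t xor h (b + suc t)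
    quot j = h j xor (h (b + j) xor h (b + suc j))

    q : Poly
    q = polyOf (b + b) quot

    O qf : ℕ → Bool
    O i  = coeff (toList (run circuit x)) i
    qf i = coeff (q *ₚ fpoly b) i

    h-vanish : ∀ {t} → b + b ≤ t → h t ≡ false
    h-vanish b+b≤t = entry-past false x _ (s≤s (+-monoʳ-≤ (b + b) b+b≤t))

    Z-high : ∀ {t} → b' ≤ t → Z t ≡ h t
    Z-high b'≤t = trans (cong (h _ xor_) (h-vanish (+-monoʳ-≤ b (s≤s b'≤t)))) (xor-identityʳ _)

    quot-high : ∀ {j} → b ≤ j → quot j ≡ h j
    quot-high {j} b≤j = begin
      h j xor (h (b + j) xor h (b + suc j))  ≡⟨ cong₂ (λ u v → h j xor (u xor v)) (h-vanish (+-monoʳ-≤ b b≤j))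
                                                  (h-vanish (+-monoʳ-≤ b (m≤n⇒m≤1+n b≤j))) ⟩
      h j xor false                          ≡⟨ xor-identityʳ (h j) ⟩
      h j                                    ∎

    coeff-q : ∀ j → coeff q j ≡ quot j
    coeff-q j = coeff-polyOf (b + b) quot j
      (λ b+b≤j → trans (quot-high (≤-trans b≤2b b+b≤j)) (h-vanish b+b≤j))

    wire-input : ∀ {i} → i < suc w₀ → wire C₁ x i ≡ d i
    wire-input {i} = layer-wire-old inputs c₁ left₁ right₁ x i

    wire-gate₁ : ∀ g → g < c₁ → wire C₁ x (gate₁ g) ≡ (d (left₁ g) xor d (right₁ g))
    wire-gate₁ g g<c₁ = layer-wire-new inputs c₁ left₁ right₁ x g g<c₁ (left₁-range g g<c₁) (right₁-range g g<c₁)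

    wire-V : ∀ {s} → s < b → wire C₁ x (vWire s) ≡ V s
    wire-V {s} s<b = trans (wire-gate₁ s (<-≤-trans s<b (m≤m+n b b')))
                           (cong₂ _xor_ (cong d (left₁-low s<b)) (cong d (right₁-low s<b)))

    wire-Z : ∀ t → t ≤ b → wire C₁ x (zWire t) ≡ Z t
    wire-Z t t≤b with <-≤-connex t b'
    ... | inj₁ t<b' = begin
      wire C₁ x (zWire t)                            ≡⟨ cong (wire C₁ x) (piecewise-< _ _ t<b') ⟩
      wire C₁ x (gate₁ (b + t))                      ≡⟨ wire-gate₁ (b + t) (+-monoʳ-< b t<b') ⟩
      d (left₁ (b + t)) xor d (right₁ (b + t))       ≡⟨ cong₂ _xor_ (cong d (left₁-high t)) (cong d (right₁-high t)) ⟩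
      Z t                                            ∎
    ... | inj₂ b'≤t = begin
      wire C₁ x (zWire t)   ≡⟨ cong (wire C₁ x) (piecewise-≥ _ _ b'≤t) ⟩
      wire C₁ x (hWire t)   ≡⟨ wire-input (hWire-range (≤-<-trans t≤b (m<m+n b (s≤s z≤n)))) ⟩
      h t                   ≡⟨ sym (Z-high b'≤t) ⟩
      Z t                   ∎

    correction : ℕ → Bool
    correction k = Z (π k) xor wire C₁ x (xWire k)

    output-low : ∀ k → k < m → O k ≡ (d k xor correction k)
    output-low k k<m = begin
      coeff (toList (run circuit x)) k
        ≡⟨ coeff-toList (run circuit x) k ⟩
      entry false (map (lookup (values C₃ x)) (tabulate {n = m} (λ i → suc (toℕ i + w₂) mod suc (m + w₂)))) k
        ≡⟨ cong (λ v → entry false v k) (sym (tabulate-∘ {n = m} (lookup (values C₃ x)) (λ i → suc (toℕ i + w₂) mod suc (m + w₂)))) ⟩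
      entry false (tabulate {n = m} (λ i → lookup (values C₃ x) (suc (toℕ i + w₂) mod suc (m + w₂)))) k
        ≡⟨ entry-tabulate {n = m} false (λ i → lookup (values C₃ x) (suc (i + w₂) mod suc (m + w₂))) k k<m ⟩
      lookup (values C₃ x) (suc (k + w₂) mod suc (m + w₂))
        ≡⟨ entry-mod false (values C₃ x) _ (s≤s (+-monoˡ-< w₂ k<m)) ⟩
      wire C₃ x (suc (k + w₂))
        ≡⟨ layer-wire-new C₂ m _ xWire x k k<m (left₃-range k k<m) (wire-range-weaken m w₁ (xWire-range k k<m)) ⟩
      wire C₂ x (suc (k + w₁)) xor wire C₂ x (xWire k)
        ≡⟨ cong₂ _xor_ (layer-wire-new C₁ m _ _ x k k<m (left₂-range k k<m) (zWire-range (π k) (π-range k k<m)))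
                       (layer-wire-old C₁ m (λ i → i) (zWire ∘ π) x (xWire k) (xWire-range k k<m)) ⟩
      (wire C₁ x k xor wire C₁ x (zWire (π k))) xor wire C₁ x (xWire k)
        ≡⟨ cong (λ u → (u xor wire C₁ x (zWire (π k))) xor wire C₁ x (xWire k))
                (wire-input (≤-trans k<m (s≤s (m≤m+n (b + b) (b + b))))) ⟩
      (d k xor wire C₁ x (zWire (π k))) xor wire C₁ x (xWire k)
        ≡⟨ cong (λ u → (d k xor u) xor wire C₁ x (xWire k)) (wire-Z (π k) (π-range k k<m)) ⟩
      (d k xor Z (π k)) xor wire C₁ x (xWire k)
        ≡⟨ xor-assoc (d k) (Z (π k)) _ ⟩
      d k xor correction k
        ∎

    output-high : ∀ j → O (m + j) ≡ false
    output-high j = trans (coeff-toList (run circuit x) (m + j)) (entry-past false (run circuit x) (m + j) (m≤m+n m j))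

    qf-terms : ∀ i {s₁ s₂ s₃ s₄ s₅} →
      coeff (shift m q) i ≡ s₁ → coeff (shift (suc b) q) i ≡ s₂ → coeff (shift b q) i ≡ s₃ →
      coeff (shift 1 q) i ≡ s₄ → coeff q i ≡ s₅ → qf i ≡ ((((s₁ xor s₂) xor s₃) xor s₄) xor s₅)
    qf-terms i {s₁} {s₂} {s₃} {s₄} {s₅} e₁ e₂ e₃ e₄ e₅ = begin
      qf i
        ≡⟨ coeff-*-fpoly b q i ⟩
      (((coeff (shift (2 * b + 1) q) i xor coeff (shift (b + 1) q) i) xor coeff (shift b q) i) xor coeff (shift 1 q) i) xor coeff q i
        ≡⟨ cong₂ (λ k l → (((coeff (shift k q) i xor coeff (shift l q) i) xor coeff (shift b q) i) xor coeff (shift 1 q) i) xor coeff q i)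
                 (degree-eq b) (+-comm b 1) ⟩
      (((coeff (shift m q) i xor coeff (shift (suc b) q) i) xor coeff (shift b q) i) xor coeff (shift 1 q) i) xor coeff q i
        ≡⟨ cong₂ _xor_ (cong₂ _xor_ (cong₂ _xor_ (cong₂ _xor_ e₁ e₂) e₃) e₄) e₅ ⟩
      (((s₁ xor s₂) xor s₃) xor s₄) xor s₅
        ∎

    q-at : ∀ k {i} j → i ≡ k + j → coeff (shift k q) i ≡ quot j
    q-at k j i≡k+j = trans (coeff-shift q k j i≡k+j) (coeff-q j)

    correction-bottom : correction 0 ≡ qf 0
    correction-bottom = begin
      Z (π 0) xor wire C₁ x (zWire b)   ≡⟨ cong₂ _xor_ (cong Z (piecewise-< _ _ (s≤s z≤n))) (wire-Z b ≤-refl) ⟩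
      Z 0 xor Z b                       ≡⟨ cong (Z 0 xor_) (trans (Z-high (n≤1+n b')) (cong h (sym (+-identityʳ b)))) ⟩
      Z 0 xor h (b + 0)                 ≡⟨ identity (h 0) (h (b + 0)) (h (b + 1)) ⟩
      quot 0                            ≡⟨ sym (qf-terms 0 refl refl refl refl (coeff-q 0)) ⟩
      qf 0                              ∎
      where
        identity : ∀ a u v → ((a xor v) xor u) ≡ (a xor (u xor v))
        identity = solve-∀ 𝔽₂

    correction-low : ∀ k → k < b' → correction (suc k) ≡ qf (suc k)
    correction-low k k<b' = begin
      Z (π (suc k)) xor wire C₁ x (xWire (suc k))
        ≡⟨ cong₂ _xor_ (cong Z (piecewise-< _ _ (s≤s k<b'))) (trans (cong (wire C₁ x) (piecewise-< _ _ k<b)) (wire-V k<b)) ⟩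
      Z (suc k) xor V k
        ≡⟨ identity (h k) (h (suc k)) (h (b + k)) (h (b + suc k)) (h (b + suc (suc k))) ⟩
      quot k xor quot (suc k)
        ≡⟨ sym (qf-terms (suc k) (coeff-shift-< q (s≤s (≤-trans (<⇒≤ (s≤s k<b')) b≤2b)))
                 (coeff-shift-< q (s≤s k<b)) (coeff-shift-< q (s≤s k<b')) (q-at 1 k refl) (coeff-q (suc k))) ⟩
      qf (suc k)
        ∎
      where
        k<b : k < b
        k<b = m<n⇒m<1+n k<b'
        identity : ∀ a a′ c c′ c″ → ((a′ xor c″) xor (a xor c)) ≡ ((a xor (c xor c′)) xor (a′ xor (c′ xor c″)))
        identity = solve-∀ 𝔽₂

    correction-middle : correction b ≡ qf b
    correction-middle = begin
      Z (π b) xor wire C₁ x (xWire b)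
        ≡⟨ cong₂ _xor_ (cong Z π-middle) (trans (cong (wire C₁ x) (piecewise-< _ _ ≤-refl)) (wire-V ≤-refl)) ⟩
      Z 0 xor V b'
        ≡⟨ identity (h 0) (h (b + 0)) (h (b + 1)) (V b') ⟩
      (quot 0 xor V b') xor h (b + 0)
        ≡⟨ sym (qf-terms b (coeff-shift-< q (s≤s b≤2b)) (coeff-shift-< q (n<1+n b)) (q-at b 0 (sym (+-identityʳ b)))
                 (trans (q-at 1 b' refl) quot-top) (trans (coeff-q b) (trans (quot-high ≤-refl) (cong h (sym (+-identityʳ b)))))) ⟩
      qf b
        ∎
      where
        quot-top : quot b' ≡ V b'
        quot-top = trans (cong (λ u → h b' xor (h (b + b') xor u)) (h-vanish ≤-refl))
                         (cong (h b' xor_) (xor-identityʳ _))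
        identity : ∀ a u v t → ((a xor v) xor t) ≡ (((a xor (u xor v)) xor t) xor u)
        identity = solve-∀ 𝔽₂

    correction-high : ∀ j → j < b → correction (suc (b + j)) ≡ qf (suc (b + j))
    correction-high j j<b = begin
      Z (π (suc (b + j))) xor wire C₁ x (xWire (suc (b + j)))
        ≡⟨ cong₂ _xor_ (cong Z (π-high j)) (trans (cong (wire C₁ x) (xWire-high j)) (wire-Z (suc j) j<b)) ⟩
      Z j xor Z (suc j)
        ≡⟨ identity (h j) (h (suc j)) (h (b + j)) (h (b + suc j)) (h (b + suc (suc j))) ⟩
      ((quot j xor quot (suc j)) xor h (b + j)) xor h (b + suc j)
        ≡⟨ sym (qf-terms (suc (b + j)) (coeff-shift-< q (s≤s (+-monoʳ-< b j<b))) (q-at (suc b) j refl)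
                 (q-at b (suc j) (sym (+-suc b j)))
                 (trans (q-at 1 (b + j) refl) (quot-high (m≤m+n b j)))
                 (trans (coeff-q _) (trans (quot-high (m≤n⇒m≤1+n (m≤m+n b j))) (cong h (sym (+-suc b j)))))) ⟩
      qf (suc (b + j))
        ∎
      where
        identity : ∀ a a′ c c′ c″ → ((a xor c′) xor (a′ xor c″)) ≡ (((a xor (c xor c′)) xor (a′ xor (c′ xor c″))) xor c) xor c′
        identity = solve-∀ 𝔽₂

    qf-top : ∀ j → qf (m + j) ≡ h j
    qf-top j = begin
      qf (m + j)
        ≡⟨ qf-terms (m + j) (q-at m j refl) (trans (q-at (suc b) (b + j) (cong suc (+-assoc b b j))) (quot-high (m≤m+n b j)))
             (trans (q-at b (b + suc j) (top-shift-eq b j)) (quot-high (m≤m+n b (suc j))))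
             (trans (q-at 1 ((b + b) + j) refl) (quot-vanish (m≤m+n (b + b) j)))
             (trans (coeff-q (m + j)) (quot-vanish (m≤n⇒m≤1+n (m≤m+n (b + b) j)))) ⟩
      (((quot j xor h (b + j)) xor h (b + suc j)) xor false) xor false
        ≡⟨ identity (h j) (h (b + j)) (h (b + suc j)) ⟩
      h j
        ∎
      where
        quot-vanish : ∀ {i} → b + b ≤ i → quot i ≡ false
        quot-vanish b+b≤i = trans (quot-high (≤-trans b≤2b b+b≤i)) (h-vanish b+b≤i)
        identity : ∀ a u v → ((((a xor (u xor v)) xor u) xor v) xor false) xor false ≡ a
        identity = solve-∀ 𝔽₂

    correction-correct : ∀ k → k < m → correction k ≡ qf k
    correction-correct k k<m with below-or-offset b k
    correction-correct zero    k<m | inj₁ _   = correction-bottom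
    correction-correct (suc k) k<m | inj₁ k<b = correction-low k (≤-pred k<b)
    ... | inj₂ (zero  , k≡b+0) = subst (λ i → correction i ≡ qf i) (sym (trans k≡b+0 (+-identityʳ b))) correction-middle
    ... | inj₂ (suc j , k≡b+sj) = subst (λ i → correction i ≡ qf i) (sym k≡) (correction-high j j<b)
      where
        k≡ : k ≡ suc (b + j)
        k≡ = trans k≡b+sj (+-suc b j)
        j<b : j < b
        j<b = +-cancelˡ-< b j b (≤-pred (subst (_< m) k≡ k<m))

    coefficient-correct : ∀ i → d i ≡ (O i xor qf i)
    coefficient-correct i with below-or-offset m i
    ... | inj₁ i<m = begin
      d i                                       ≡⟨ sym (cancel (d i) (qf i)) ⟩
      (d i xor qf i) xor qf i                   ≡⟨ cong (λ c → (d i xor c) xor qf i) (sym (correction-correct i i<m)) ⟩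
      (d i xor correction i) xor qf i           ≡⟨ cong (_xor qf i) (sym (output-low i i<m)) ⟩
      O i xor qf i                              ∎
      where
        cancel : ∀ a c → (a xor c) xor c ≡ a
        cancel = solve-∀ 𝔽₂
    ... | inj₂ (j , refl) = sym (trans (cong (_xor qf (m + j)) (output-high j)) (qf-top j))

    reduction-correct : toList x ≈ₚ (toList (run circuit x) +ₚ q *ₚ fpoly b)
    reduction-correct i = begin
      coeff (toList x) i                                  ≡⟨ coeff-toList x i ⟩
      d i                                                 ≡⟨ coefficient-correct i ⟩
      O i xor qf i                                        ≡⟨ sym (coeff-+ (toList (run circuit x)) (q *ₚ fpoly b) i) ⟩
      coeff (toList (run circuit x) +ₚ q *ₚ fpoly b) i    ∎

Reduction : ℕ → ℕ → ℕ → ℕ → Set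
Reduction b n k g = Σ (XorCircuit n k g) λ C →
  (delay C ≤ 3) × ((d : Vec Bool n) → Σ Poly λ q → toList d ≈ₚ (toList (run C d) +ₚ q *ₚ fpoly b))

reindex : ∀ {b n n′ k k′ g g′} → n ≡ n′ → k ≡ k′ → g ≡ g′ → Reduction b n k g → Reduction b n′ k′ g′
reindex refl refl refl R = R

construction : ∀ b' → Reduction (suc b') (suc (Construction.w₀ b')) (Construction.m b') (Construction.gates b')
construction b' = circuit , delay-bound circuit circuit-depth , λ x → Evaluation.q x , Evaluation.reduction-correct x
  where open Construction b'

theorem1 : (b : ℕ) → 2 ≤ b →
    Σ (XorCircuit (2 * (2 * b + 1) ∸ 1) (2 * b + 1) (3 * (2 * b + 1) ∸ 2)) λ C →
    (delay C ≤ 3) ×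
    ((d : Vec Bool (2 * (2 * b + 1) ∸ 1)) →
    Σ Poly λ q → toList d ≈ₚ (toList (run C d) +ₚ q *ₚ fpoly b))
theorem1 zero    ()
theorem1 (suc b') _ =
  reindex {b = suc b'} (sym (cong (_∸ 1) (input-count-eq (suc b')))) (sym (degree-eq (suc b')))
          (sym (cong (_∸ 2) (gate-count-eq b'))) (construction b')
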